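{- Let $k\ge 1$ be an integer. Let $G_L$ be an $\ell$-$LP_0$-snark with $\sigma\ge1$ link-vertices, where $\ell\ge 3$ is odd. Then $i_{[kR]}(G_L)\le 2(k+1)\ell+(k-1)\sigma$.
   Context: A basic block $B_i$ has vertices $p_i,q_i,r_i,s_i,t_i,u_i,v_i$ and edges $p_it_i,t_iq_i,q_ir_i,r_is_i,s_ip_i,u_iv_i,u_ip_i,v_iq_i$. For odd $\ell\ge3$, an $\ell$-$LP_1$-snark is built from disjoint blocks $B_0,\ldots,B_{\ell-1}$: for each $i\in\{0,\ldots,\ell-1\}$ (indices modulo $\ell$) add either the pair of edges $\{s_ir_{i+1},v_iu_{i+1}\}$ or the pair $\{s_iu_{i+1},v_ir_{i+1}\}$; then choose an odd number $\sigma$ with $1\le\sigma\le\lfloor\ell/3\rfloor$ of pairwise disjoint triples $\{t_i,t_j,t_s\}$ and for each add a new vertex (link-vertex) adjacent to its three vertices; finally, the remaining $\ell-3\sigma$ vertices $t_i$ are paired up and each pair is joined by an edge (repairing edge). An $\ell$-$LP_0$-snark is an $\ell$-$LP_1$-snark in which every link-vertex is adjacent to $t_i,t_{i+1},t_{i+2}$ for some $i$ and every repairing edge is of the form $t_it_{i+1}$ (indices modulo $\ell$). For $f\colon V(G)\to\mathbb{Z}_{\ge 0}$ and $S\subseteq V(G)$, $f(S)=\sum_{v\in S}f(v)$, and $AN(v)=\{w\in N(v): f(w)\ge 1\}$. A $[k]$-Roman dominating function of $G$ is a function $f\colon V(G)\to\{0,1,\ldots,k+1\}$ such that $f(N[v])\ge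 k+|AN(v)|$ for every vertex $v$ with $f(v)<k$; its weight is $f(V(G))$. $i_{[kR]}(G)$ is the minimum weight of such a function whose set of vertices with positive label is independent. -}

module Defs where

open import Data.Nat using (ℕ; zero; suc; _+_; _*_; _≤_; _<_; _≡ᵇ_; _≤ᵇ_)
open import Data.Nat.DivMod using (_/_)
open import Data.Bool using (Bool; true; false; _∧_; _∨_; if_then_else_; not)
open import Data.Fin using (Fin; toℕ)
open import Data.Product using (_×_; _,_; Σ; ∃)
open import Data.Sum using (_⊎_; inj₁; inj₂)
open import Relation.Binary.PropositionalEquality using (_≡_)

Odd : ℕ → Set
Odd n = ∃ λ m → n ≡ suc (2 * m)

sumFin : (n : ℕ) → (Fin n → ℕ) → ℕ
sumFin zero    f = 0
sumFin (suc n) f = f Fin.zero + sumFin n (λ i → f (Fin.suc i))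

b2n : Bool → ℕ
b2n true  = 1
b2n false = 0

nx : ℕ → ℕ → ℕ
nx ℓ n = if suc n ≡ᵇ ℓ then 0 else suc n

-- Vertices of an ℓ-LP-snark with σ link-vertices:
-- inj₁ (i , c) is vertex c of block B_i, with codes
--   p = 0, q = 1, r = 2, s = 3, t = 4, u = 5, v = 6;
-- inj₂ j is the j-th link-vertex.
V : ℕ → ℕ → Set
V ℓ σ = (Fin ℓ × Fin 7) ⊎ Fin σ

-- edges inside a basic block: pt, tq, qr, rs, sp, uv, up, vq
inner : ℕ → ℕ → Bool
inner 0 4 = true
inner 4 1 = true
inner 1 2 = true
inner 2 3 = true
inner 3 0 = true
inner 5 6 = true
inner 5 0 = true
inner 6 1 = true
inner _ _ = false

-- edges from block i to block i+1:
-- false : {s_i r_{i+1}, v_i u_{i+1}};  true : {s_i u_{i+1}, v_i r_{i+1}}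
cross : Bool → ℕ → ℕ → Bool
cross false 3 2 = true
cross false 6 5 = true
cross true  3 5 = true
cross true  6 2 = true
cross _ _ _ = false

-- Data of an ℓ-LP_0-snark:
--   twist i   : which pair of edges joins B_i to B_{i+1};
--   start j   : link-vertex j is adjacent to t_a, t_{a+1}, t_{a+2} with a = start j;
--   repair i  : the repairing edge t_i t_{i+1} is present.
record LP0Data (ℓ σ : ℕ) : Set where
  field
    twist  : Fin ℓ → Bool
    start  : Fin σ → Fin ℓ
    repair : Fin ℓ → Bool
open LP0Data public

inTriple : ℕ → ℕ → ℕ → Bool
inTriple ℓ a x = (x ≡ᵇ a) ∨ ((x ≡ᵇ nx ℓ a) ∨ (x ≡ᵇ nx ℓ (nx ℓ a)))

cover : ∀ {ℓ σ} → LP0Data ℓ σ → Fin ℓ → ℕ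
cover {ℓ} {σ} D x =
  sumFin σ (λ j → b2n (inTriple ℓ (toℕ (start D j)) (toℕ x)))
  + sumFin ℓ (λ i → b2n (repair D i ∧ ((toℕ i ≡ᵇ toℕ x) ∨ (nx ℓ (toℕ i) ≡ᵇ toℕ x))))

-- validity: every t_x lies in exactly one link triple or exactly one
-- repairing edge (so the link triples are pairwise disjoint and the
-- repairing edges perfectly pair up the remaining t-vertices)
ValidLP0 : ∀ {ℓ σ} → LP0Data ℓ σ → Set
ValidLP0 {ℓ} D = ∀ x → cover D x ≡ 1

edge : ∀ {ℓ σ} → LP0Data ℓ σ → V ℓ σ → V ℓ σ → Bool
edge {ℓ} D (inj₁ (i , a)) (inj₁ (j , b)) =
  ((toℕ i ≡ᵇ toℕ j) ∧ inner (toℕ a) (toℕ b))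
  ∨ (((nx ℓ (toℕ i) ≡ᵇ toℕ j) ∧ cross (twist D i) (toℕ a) (toℕ b))
  ∨ (repair D i ∧ ((nx ℓ (toℕ i) ≡ᵇ toℕ j) ∧ ((toℕ a ≡ᵇ 4) ∧ (toℕ b ≡ᵇ 4)))))
edge {ℓ} D (inj₂ j) (inj₁ (i , a)) = (toℕ a ≡ᵇ 4) ∧ inTriple ℓ (toℕ (start D j)) (toℕ i)
edge D (inj₁ _) (inj₂ _) = false
edge D (inj₂ _) (inj₂ _) = false

adj : ∀ {ℓ σ} → LP0Data ℓ σ → V ℓ σ → V ℓ σ → Bool
adj D v w = edge D v w ∨ edge D w v

eqV : ∀ {ℓ σ} → V ℓ σ → V ℓ σ → Bool
eqV (inj₁ (i , a)) (inj₁ (j , b)) = (toℕ i ≡ᵇ toℕ j) ∧ (toℕ a ≡ᵇ toℕ b)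
eqV (inj₂ i) (inj₂ j) = toℕ i ≡ᵇ toℕ j
eqV _ _ = false

sumV : ∀ ℓ σ → (V ℓ σ → ℕ) → ℕ
sumV ℓ σ g = sumFin ℓ (λ i → sumFin 7 (λ c → g (inj₁ (i , c)))) + sumFin σ (λ j → g (inj₂ j))

fClosedNbhd : ∀ {ℓ σ} → LP0Data ℓ σ → (V ℓ σ → ℕ) → V ℓ σ → ℕ
fClosedNbhd {ℓ} {σ} D f v = sumV ℓ σ (λ w → if adj D v w ∨ eqV v w then f w else 0)

activeNbrs : ∀ {ℓ σ} → LP0Data ℓ σ → (V ℓ σ → ℕ) → V ℓ σ → ℕ
activeNbrs {ℓ} {σ} D f v = sumV ℓ σ (λ w → b2n (adj D v w ∧ (1 ≤ᵇ f w)))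

weight : ∀ {ℓ σ} → (V ℓ σ → ℕ) → ℕ
weight {ℓ} {σ} f = sumV ℓ σ f

IsKRDF : ∀ {ℓ σ} → LP0Data ℓ σ → ℕ → (V ℓ σ → ℕ) → Set
IsKRDF D k f =
  (∀ v → f v ≤ k + 1) ×
  (∀ v → f v < k → k + activeNbrs D f v ≤ fClosedNbhd D f v)

IsIKRDF : ∀ {ℓ σ} → LP0Data ℓ σ → ℕ → (V ℓ σ → ℕ) → Set
IsIKRDF D k f =
  IsKRDF D k f ×
  (∀ v w → adj D v w ≡ true → 1 ≤ f v → 1 ≤ f w → Data.Empty.⊥)
  where import Data.Empty

IKRDomLe : ∀ {ℓ σ} → LP0Data ℓ σ → ℕ → ℕ → Set
IKRDomLe {ℓ} {σ} D k b = Σ (V ℓ σ → ℕ) λ f → IsIKRDF D k f × (weight f ≤ b)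

-- Label each block by its role. A block whose t-vertex lies on a repairing edge gets k+1 on p
-- and q. In a link triple B_a, B_{a+1}, B_{a+2} the first block gets k+1 on s, v and k on t, the
-- middle one k+1 on t, and the last one k+1 on r, u and k on t; link-vertices get 0. Every vertex
-- labelled 0 then has a neighbour labelled k+1, which alone gives f(N[v]) ≥ k + |AN(v)|. The
-- positive vertices are independent: inside a block this is a finite check, and between
-- consecutive blocks only a first block has positive s, v, but it is followed by a middle block,
-- whose r, u are 0. A repaired block weighs 2(k+1) and a link triple 6(k+1) + (k-1); the triples
-- cover 3σ blocks and all other blocks are repaired, so the weight is 2(k+1)ℓ + (k-1)σ.

{-# OPTIONS --safe #-}
module Submission where

open import Defs
open import Data.Nat using (ℕ; _+_; _*_; _∸_; _≤_)
open import Data.Nat.DivMod using (_/_)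
open import Data.Nat.Base using (zero; suc; _<_; _≡ᵇ_; _≤ᵇ_; z≤n; s≤s)
open import Data.Nat.Properties
open import Data.Nat.Tactic.RingSolver using (solve; solve-∀)
open import Algebra.Properties.CommutativeSemigroup +-commutativeSemigroup
  using () renaming (interchange to +-interchange; x∙yz≈y∙xz to x+[y+z]≡y+[x+z])
open import Data.Bool.Base using (Bool; true; false; _∧_; _∨_; if_then_else_; T)
open import Data.Bool.Properties using (T-∨; T-∧; T-≡; ∨-comm; ∨-zeroʳ)
open import Data.Fin.Base using (Fin; toℕ; fromℕ<)
open import Data.Fin.Properties using (toℕ<n; toℕ-fromℕ<; toℕ-injective; all?; any?)
  renaming (suc-injective to Fin-suc-injective; _≟_ to _≟ᶠ_)
open import Data.List.Base using ([]; _∷_)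
open import Data.Product using (Σ; Σ-syntax; _×_; _,_; proj₂)
open import Data.Sum using (inj₁; inj₂)
open import Data.Unit using (tt)
open import Data.Empty using (⊥; ⊥-elim)
open import Function using (_∘_; _∘′_)
open import Function.Bundles using (Equivalence)
open import Relation.Nullary using (Dec; yes; no; ¬_; ¬?)
open import Relation.Nullary.Decidable using (dec-true; dec-false; from-yes; map′; _×-dec_; _→-dec_; T?)
open import Relation.Unary using (Decidable)
open import Relation.Binary.PropositionalEquality

open Equivalence using (to; from)

infixr 8 [_]·_

[_]·_ : Bool → ℕ → ℕ
[ b ]· x = if b then x else 0

b2n-T : ∀ {b} → T b → b2n b ≡ 1
b2n-T {true} _ = refl

b2n-¬T : ∀ {b} → ¬ T b → b2n b ≡ 0
b2n-¬T {true}  ¬t = ⊥-elim (¬t tt)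
b2n-¬T {false} _  = refl

[≡ᵇ]·-refl : ∀ m x → [ m ≡ᵇ m ]· x ≡ x
[≡ᵇ]·-refl m x = cong ([_]· x) (dec-true (m ≟ m) refl)

[≡ᵇ]·-≢ : ∀ {m n} x → m ≢ n → [ m ≡ᵇ n ]· x ≡ 0
[≡ᵇ]·-≢ {m} {n} x m≢n = cong ([_]· x) (dec-false (m ≟ n) m≢n)

sumFin-cong : ∀ n {g h : Fin n → ℕ} → (∀ i → g i ≡ h i) → sumFin n g ≡ sumFin n h
sumFin-cong zero    g≗h = refl
sumFin-cong (suc n) g≗h = cong₂ _+_ (g≗h Fin.zero) (sumFin-cong n (g≗h ∘ Fin.suc))

sumFin-const : ∀ n c → sumFin n (λ _ → c) ≡ n * c
sumFin-const zero    c = refl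
sumFin-const (suc n) c = cong (c +_) (sumFin-const n c)

sumFin-0 : ∀ n → sumFin n (λ _ → 0) ≡ 0
sumFin-0 n = trans (sumFin-const n 0) (*-zeroʳ n)

sumFin-distrib-+ : ∀ n (g h : Fin n → ℕ) → sumFin n (λ i → g i + h i) ≡ sumFin n g + sumFin n h
sumFin-distrib-+ zero    g h = refl
sumFin-distrib-+ (suc n) g h =
  trans (cong (g Fin.zero + h Fin.zero +_) (sumFin-distrib-+ n (g ∘ Fin.suc) (h ∘ Fin.suc)))
        (+-interchange (g Fin.zero) (h Fin.zero) _ _)

sumFin-comm : ∀ m n (g : Fin m → Fin n → ℕ) →
              sumFin m (λ i → sumFin n (g i)) ≡ sumFin n (λ j → sumFin m (λ i → g i j))
sumFin-comm zero    n g = sym (sumFin-0 n)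
sumFin-comm (suc m) n g =
  trans (cong (sumFin n (g Fin.zero) +_) (sumFin-comm m n (g ∘ Fin.suc)))
        (sym (sumFin-distrib-+ n (g Fin.zero) _))

sumFin-[]·-const : ∀ n (b : Fin n → Bool) x →
                   sumFin n (λ i → [ b i ]· x) ≡ sumFin n (λ i → [ b i ]· 1) * x
sumFin-[]·-const zero    b x = refl
sumFin-[]·-const (suc n) b x =
  trans (cong₂ _+_ (unit (b Fin.zero)) (sumFin-[]·-const n (b ∘ Fin.suc) x))
        (sym (*-distribʳ-+ x ([ b Fin.zero ]· 1) _))
  where
  unit : ∀ c → [ c ]· x ≡ [ c ]· 1 * x
  unit true  = sym (+-identityʳ x)
  unit false = refl

sumFin-indicator : ∀ n {m} x → m < n → sumFin n (λ i → [ toℕ i ≡ᵇ m ]· x) ≡ x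
sumFin-indicator (suc n) {zero}  x _         = trans (cong (x +_) (sumFin-0 n)) (+-identityʳ x)
sumFin-indicator (suc n) {suc m} x (s≤s m<n) = sumFin-indicator n x m<n

sumFin-mono : ∀ n {g h : Fin n → ℕ} → (∀ i → g i ≤ h i) → sumFin n g ≤ sumFin n h
sumFin-mono zero    g≤h = z≤n
sumFin-mono (suc n) g≤h = +-mono-≤ (g≤h Fin.zero) (sumFin-mono n (g≤h ∘ Fin.suc))

sumFin-mono-with : ∀ n {g h : Fin n → ℕ} x j → (∀ i → g i ≤ h i) → x + g j ≤ h j →
                   x + sumFin n g ≤ sumFin n h
sumFin-mono-with (suc n) {g} {h} x Fin.zero g≤h x+g≤h =
  subst (_≤ sumFin (suc n) h) (+-assoc x (g Fin.zero) _)
        (+-mono-≤ x+g≤h (sumFin-mono n (g≤h ∘ Fin.suc)))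
sumFin-mono-with (suc n) {g} {h} x (Fin.suc j) g≤h x+g≤h =
  subst (_≤ sumFin (suc n) h) (x+[y+z]≡y+[x+z] (g Fin.zero) x _)
        (+-mono-≤ (g≤h Fin.zero) (sumFin-mono-with n {h = h ∘ Fin.suc} x j (g≤h ∘ Fin.suc) x+g≤h))

term≤sumFin : ∀ n (g : Fin n → ℕ) i → g i ≤ sumFin n g
term≤sumFin (suc n) g Fin.zero    = m≤m+n _ _
term≤sumFin (suc n) g (Fin.suc i) = m≤n⇒m≤o+n (g Fin.zero) (term≤sumFin n (g ∘ Fin.suc) i)

two-terms≤sumFin : ∀ n (g : Fin n → ℕ) {i j} → i ≢ j → g i + g j ≤ sumFin n g
two-terms≤sumFin (suc n) g {Fin.zero}  {Fin.zero}  i≢j = ⊥-elim (i≢j refl)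
two-terms≤sumFin (suc n) g {Fin.zero}  {Fin.suc j} _   =
  +-monoʳ-≤ (g Fin.zero) (term≤sumFin n (g ∘ Fin.suc) j)
two-terms≤sumFin (suc n) g {Fin.suc i} {Fin.zero}  _   =
  subst (_≤ sumFin (suc n) g) (+-comm (g Fin.zero) _)
        (+-monoʳ-≤ (g Fin.zero) (term≤sumFin n (g ∘ Fin.suc) i))
two-terms≤sumFin (suc n) g {Fin.suc i} {Fin.suc j} i≢j =
  m≤n⇒m≤o+n (g Fin.zero) (two-terms≤sumFin n (g ∘ Fin.suc) (i≢j ∘ cong Fin.suc))

sumFin-single : ∀ n (g : Fin n → ℕ) j → (∀ i → i ≢ j → g i ≡ 0) → sumFin n g ≡ g j
sumFin-single (suc n) g Fin.zero others =
  trans (cong (g Fin.zero +_) (trans (sumFin-cong n (λ i → others (Fin.suc i) λ ())) (sumFin-0 n)))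
        (+-identityʳ _)
sumFin-single (suc n) g (Fin.suc j) others =
  cong₂ _+_ (others Fin.zero λ ())
            (sumFin-single n (g ∘ Fin.suc) j (λ i i≢j → others (Fin.suc i) (i≢j ∘ Fin-suc-injective)))

nx-wrap : ∀ {ℓ n} → suc n ≡ ℓ → nx ℓ n ≡ 0
nx-wrap {ℓ} {n} e = cong (λ b → if b then 0 else suc n) (dec-true (suc n ≟ ℓ) e)

nx-step : ∀ {ℓ n} → suc n ≢ ℓ → nx ℓ n ≡ suc n
nx-step {ℓ} {n} ne = cong (λ b → if b then 0 else suc n) (dec-false (suc n ≟ ℓ) ne)

nx<ℓ : ∀ {ℓ n} → n < ℓ → nx ℓ n < ℓ
nx<ℓ {ℓ} {n} n<ℓ with suc n ≟ ℓ
... | yes e  = subst (_< ℓ) (sym (nx-wrap e)) (≤-trans (s≤s z≤n) n<ℓ)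
... | no  ne = subst (_< ℓ) (sym (nx-step ne)) (≤∧≢⇒< n<ℓ ne)

nx≢id : ∀ {ℓ} n → 2 ≤ ℓ → nx ℓ n ≢ n
nx≢id {ℓ} n 2≤ℓ nx≡n with suc n ≟ ℓ
... | yes e  = <⇒≢ 2≤ℓ (trans (cong suc (trans (sym (nx-wrap e)) nx≡n)) e)
... | no  ne = 1+n≢n (trans (sym (nx-step ne)) nx≡n)

nx²≢id : ∀ {ℓ} n → 3 ≤ ℓ → nx ℓ (nx ℓ n) ≢ n
nx²≢id {ℓ} n 3≤ℓ nx²≡n with suc n ≟ ℓ
... | yes e = <⇒≢ 3≤ℓ (trans (cong suc (trans (sym nx²≡1) nx²≡n)) e)
  where
  nx²≡1 : nx ℓ (nx ℓ n) ≡ 1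
  nx²≡1 = trans (cong (nx ℓ) (nx-wrap e)) (nx-step (<⇒≢ (<⇒≤ 3≤ℓ)))
... | no ne with suc (suc n) ≟ ℓ
...   | yes e′ = <⇒≢ 3≤ℓ (trans (cong (suc ∘ suc) (trans (sym nx²≡0) nx²≡n)) e′)
  where
  nx²≡0 : nx ℓ (nx ℓ n) ≡ 0
  nx²≡0 = trans (cong (nx ℓ) (nx-step ne)) (nx-wrap e′)
...   | no ne′ = <⇒≢ (m<n⇒m<1+n (n<1+n n)) (sym (trans (sym nx²≡2+n) nx²≡n))
  where
  nx²≡2+n : nx ℓ (nx ℓ n) ≡ suc (suc n)
  nx²≡2+n = trans (cong (nx ℓ) (nx-step ne)) (nx-step ne′)

data Place : Set where
  first middle last : Place

shift : ℕ → Place → ℕ → ℕ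
shift ℓ first  a = a
shift ℓ middle a = nx ℓ a
shift ℓ last   a = nx ℓ (nx ℓ a)

shift<ℓ : ∀ {ℓ a} x → a < ℓ → shift ℓ x a < ℓ
shift<ℓ first  a<ℓ = a<ℓ
shift<ℓ middle a<ℓ = nx<ℓ a<ℓ
shift<ℓ last   a<ℓ = nx<ℓ (nx<ℓ a<ℓ)

shift-injective : ∀ {ℓ} a {x y} → 3 ≤ ℓ → shift ℓ x a ≡ shift ℓ y a → x ≡ y
shift-injective a {first}  {first}  _   _ = refl
shift-injective a {middle} {middle} _   _ = refl
shift-injective a {last}   {last}   _   _ = refl
shift-injective a {first}  {middle} 3≤ℓ e = ⊥-elim (nx≢id a (<⇒≤ 3≤ℓ) (sym e))
shift-injective a {middle} {first}  3≤ℓ e = ⊥-elim (nx≢id a (<⇒≤ 3≤ℓ) e)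
shift-injective a {first}  {last}   3≤ℓ e = ⊥-elim (nx²≢id a 3≤ℓ (sym e))
shift-injective a {last}   {first}  3≤ℓ e = ⊥-elim (nx²≢id a 3≤ℓ e)
shift-injective {ℓ} a {middle} {last}   3≤ℓ e = ⊥-elim (nx≢id (nx ℓ a) (<⇒≤ 3≤ℓ) (sym e))
shift-injective {ℓ} a {last}   {middle} 3≤ℓ e = ⊥-elim (nx≢id (nx ℓ a) (<⇒≤ 3≤ℓ) e)

sumPlaces : (Place → ℕ) → ℕ
sumPlaces g = g first + (g middle + g last)

sumPlaces-single : ∀ (g : Place → ℕ) x → (∀ y → y ≢ x → g y ≡ 0) → sumPlaces g ≡ g x
sumPlaces-single g first  others
  rewrite others middle (λ ()) | others last (λ ()) = +-identityʳ (g first)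
sumPlaces-single g middle others
  rewrite others first (λ ()) | others last (λ ()) = +-identityʳ (g middle)
sumPlaces-single g last   others
  rewrite others first (λ ()) | others middle (λ ()) = refl

inTriple-shift : ∀ ℓ a x {n} → n ≡ shift ℓ x a → T (inTriple ℓ a n)
inTriple-shift ℓ a first  refl = from T-∨ (inj₁ (≡⇒≡ᵇ a a refl))
inTriple-shift ℓ a middle refl = from (T-∨ {n₁ ≡ᵇ a}) (inj₂ (from T-∨ (inj₁ (≡⇒≡ᵇ n₁ n₁ refl))))
  where n₁ = nx ℓ a
inTriple-shift ℓ a last   refl =
  from (T-∨ {n₂ ≡ᵇ a}) (inj₂ (from (T-∨ {n₂ ≡ᵇ nx ℓ a}) (inj₂ (≡⇒≡ᵇ n₂ n₂ refl))))
  where n₂ = nx ℓ (nx ℓ a)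

inTriple⇒shift : ∀ ℓ a n → T (inTriple ℓ a n) → Σ[ x ∈ Place ] n ≡ shift ℓ x a
inTriple⇒shift ℓ a n t with to T-∨ t
... | inj₁ t₀ = first , ≡ᵇ⇒≡ n _ t₀
... | inj₂ t′ with to T-∨ t′
...   | inj₁ t₁ = middle , ≡ᵇ⇒≡ n _ t₁
...   | inj₂ t₂ = last , ≡ᵇ⇒≡ n _ t₂

atPlace : ℕ → ℕ → ℕ → (Place → ℕ) → ℕ
atPlace ℓ a n g = sumPlaces (λ x → [ n ≡ᵇ shift ℓ x a ]· g x)

atPlace-shift : ∀ {ℓ} a x (g : Place → ℕ) → 3 ≤ ℓ → atPlace ℓ a (shift ℓ x a) g ≡ g x
atPlace-shift {ℓ} a x g 3≤ℓ =
  trans (sumPlaces-single _ x others) ([≡ᵇ]·-refl (shift ℓ x a) (g x))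
  where
  others : ∀ y → y ≢ x → [ shift ℓ x a ≡ᵇ shift ℓ y a ]· g y ≡ 0
  others y y≢x = [≡ᵇ]·-≢ {shift ℓ x a} {shift ℓ y a} (g y) (y≢x ∘ sym ∘ shift-injective a 3≤ℓ)

atPlace-outside : ∀ {ℓ} a n (g : Place → ℕ) → ¬ T (inTriple ℓ a n) → atPlace ℓ a n g ≡ 0
atPlace-outside {ℓ} a n g n∉a = cong₂ _+_ (term first) (cong₂ _+_ (term middle) (term last))
  where
  term : ∀ x → [ n ≡ᵇ shift ℓ x a ]· g x ≡ 0
  term x = [≡ᵇ]·-≢ {n} {shift ℓ x a} (g x) (n∉a ∘ inTriple-shift ℓ a x)

sumFin-atPlace : ∀ {ℓ} a (g : Place → ℕ) → a < ℓ →
                 sumFin ℓ (λ i → atPlace ℓ a (toℕ i) g) ≡ sumPlaces g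
sumFin-atPlace {ℓ} a g a<ℓ =
  trans (sumFin-distrib-+ ℓ (indicator first) _)
        (cong₂ _+_ (count first)
                   (trans (sumFin-distrib-+ ℓ (indicator middle) (indicator last))
                          (cong₂ _+_ (count middle) (count last))))
  where
  indicator : Place → Fin ℓ → ℕ
  indicator x i = [ toℕ i ≡ᵇ shift ℓ x a ]· g x
  count : ∀ x → sumFin ℓ (indicator x) ≡ g x
  count x = sumFin-indicator ℓ (g x) (shift<ℓ x a<ℓ)

pattern 𝐩 = Fin.zero
pattern 𝐪 = Fin.suc 𝐩
pattern 𝐫 = Fin.suc 𝐪
pattern 𝐬 = Fin.suc 𝐫
pattern 𝐭 = Fin.suc 𝐬
pattern 𝐮 = Fin.suc 𝐭
pattern 𝐯 = Fin.suc 𝐮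

data Role : Set where
  repaired : Role
  linked   : Place → Role

data Level : Set where
  none low high : Level

active : Level → Bool
active none = false
active low  = true
active high = true

label : Role → Fin 7 → Level
label repaired        𝐩 = high
label repaired        𝐪 = high
label (linked first)  𝐬 = high
label (linked first)  𝐭 = low
label (linked first)  𝐯 = high
label (linked middle) 𝐭 = high
label (linked last)   𝐫 = high
label (linked last)   𝐭 = low
label (linked last)   𝐮 = high
label _               _ = none

all-Bool? : ∀ {p} {P : Bool → Set p} → Decidable P → Dec (∀ b → P b)
all-Bool? P? = map′ (λ (pf , pt) → λ { false → pf ; true → pt }) (λ ∀P → ∀P false , ∀P true)
                    (P? false ×-dec P? true)

BlockIndependent : Role → Set
BlockIndependent r =
  ∀ (a b : Fin 7) → T (inner (toℕ a) (toℕ b)) → T (active (label r a)) → ¬ T (active (label r b))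

block-independent? : ∀ r → Dec (BlockIndependent r)
block-independent? r = all? λ a → all? λ b →
  T? (inner (toℕ a) (toℕ b)) →-dec T? (active (label r a)) →-dec ¬? (T? (active (label r b)))

block-independent : ∀ r → BlockIndependent r
block-independent repaired        = from-yes (block-independent? repaired)
block-independent (linked first)  = from-yes (block-independent? (linked first))
block-independent (linked middle) = from-yes (block-independent? (linked middle))
block-independent (linked last)   = from-yes (block-independent? (linked last))

ExitsInactive : Role → Set
ExitsInactive r = ∀ tw (a b : Fin 7) → T (cross tw (toℕ a) (toℕ b)) → ¬ T (active (label r a))

exits-inactive? : ∀ r → Dec (ExitsInactive r)
exits-inactive? r = all-Bool? λ tw → all? λ a → all? λ b →
  T? (cross tw (toℕ a) (toℕ b)) →-dec ¬? (T? (active (label r a)))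

active-exit⇒first : ∀ r tw (a b : Fin 7) → T (cross tw (toℕ a) (toℕ b)) → T (active (label r a)) →
                    r ≡ linked first
active-exit⇒first (linked first)  _ _ _ _ _ = refl
active-exit⇒first repaired        tw a b c = ⊥-elim ∘′ from-yes (exits-inactive? repaired) tw a b c
active-exit⇒first (linked middle) tw a b c = ⊥-elim ∘′ from-yes (exits-inactive? (linked middle)) tw a b c
active-exit⇒first (linked last)   tw a b c = ⊥-elim ∘′ from-yes (exits-inactive? (linked last)) tw a b c

MiddleEntriesInactive : Set
MiddleEntriesInactive =
  ∀ tw (a b : Fin 7) → T (cross tw (toℕ a) (toℕ b)) → ¬ T (active (label (linked middle) b))

middle-entries-inactive : MiddleEntriesInactive
middle-entries-inactive = from-yes middle-entries-inactive?
  where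
  middle-entries-inactive? : Dec MiddleEntriesInactive
  middle-entries-inactive? = all-Bool? λ tw → all? λ a → all? λ b →
    T? (cross tw (toℕ a) (toℕ b)) →-dec ¬? (T? (active (label (linked middle) b)))

HighBefore : Fin 7 → Set
HighBefore c = ∀ tw → Σ[ a ∈ Fin 7 ] T (cross tw (toℕ a) (toℕ c)) × label (linked first) a ≡ high

HighAfter : Fin 7 → Set
HighAfter c = ∀ tw → Σ[ b ∈ Fin 7 ] T (cross tw (toℕ c) (toℕ b)) × label (linked last) b ≡ high

data HighSpot (r : Role) (c : Fin 7) : Set where
  inside : ∀ c′ → T (inner (toℕ c) (toℕ c′) ∨ inner (toℕ c′) (toℕ c)) → label r c′ ≡ high →
           HighSpot r c
  before : r ≡ linked middle → HighBefore c → HighSpot r c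
  after  : r ≡ linked middle → HighAfter c → HighSpot r c

high-spot : ∀ r c → label r c ≡ none → HighSpot r c
high-spot repaired        𝐩 ()
high-spot repaired        𝐪 ()
high-spot repaired        𝐫 _ = inside 𝐪 tt refl
high-spot repaired        𝐬 _ = inside 𝐩 tt refl
high-spot repaired        𝐭 _ = inside 𝐩 tt refl
high-spot repaired        𝐮 _ = inside 𝐩 tt refl
high-spot repaired        𝐯 _ = inside 𝐪 tt refl
high-spot (linked first)  𝐩 _ = inside 𝐬 tt refl
high-spot (linked first)  𝐪 _ = inside 𝐯 tt refl
high-spot (linked first)  𝐫 _ = inside 𝐬 tt refl
high-spot (linked first)  𝐬 ()
high-spot (linked first)  𝐭 ()
high-spot (linked first)  𝐮 _ = inside 𝐯 tt refl
high-spot (linked first)  𝐯 ()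
high-spot (linked middle) 𝐩 _ = inside 𝐭 tt refl
high-spot (linked middle) 𝐪 _ = inside 𝐭 tt refl
high-spot (linked middle) 𝐫 _ = before refl λ { false → 𝐬 , tt , refl ; true → 𝐯 , tt , refl }
high-spot (linked middle) 𝐬 _ = after  refl λ { false → 𝐫 , tt , refl ; true → 𝐮 , tt , refl }
high-spot (linked middle) 𝐭 ()
high-spot (linked middle) 𝐮 _ = before refl λ { false → 𝐯 , tt , refl ; true → 𝐬 , tt , refl }
high-spot (linked middle) 𝐯 _ = after  refl λ { false → 𝐮 , tt , refl ; true → 𝐫 , tt , refl }
high-spot (linked last)   𝐩 _ = inside 𝐮 tt refl
high-spot (linked last)   𝐪 _ = inside 𝐫 tt refl
high-spot (linked last)   𝐫 ()
high-spot (linked last)   𝐬 _ = inside 𝐫 tt refl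
high-spot (linked last)   𝐭 ()
high-spot (linked last)   𝐮 ()
high-spot (linked last)   𝐯 _ = inside 𝐮 tt refl

sumV-mono-with : ∀ ℓ σ {g h : V ℓ σ → ℕ} x w → (∀ v → g v ≤ h v) → x + g w ≤ h w →
                 x + sumV ℓ σ g ≤ sumV ℓ σ h
sumV-mono-with ℓ σ {g} {h} x (inj₁ (i , c)) g≤h x+g≤h =
  subst (_≤ sumV ℓ σ h) (+-assoc x _ _)
    (+-mono-≤ (sumFin-mono-with ℓ x i (λ i′ → sumFin-mono 7 (λ c′ → g≤h (inj₁ (i′ , c′))))
                                      (sumFin-mono-with 7 x c (λ c′ → g≤h (inj₁ (i , c′))) x+g≤h))
              (sumFin-mono σ (λ j → g≤h (inj₂ j))))
sumV-mono-with ℓ σ {g} {h} x (inj₂ j) g≤h x+g≤h =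
  subst (_≤ sumV ℓ σ h) (x+[y+z]≡y+[x+z] (sumFin ℓ (λ i → sumFin 7 (λ c → g (inj₁ (i , c))))) x _)
    (+-mono-≤ (sumFin-mono ℓ (λ i → sumFin-mono 7 (λ c → g≤h (inj₁ (i , c)))))
              (sumFin-mono-with σ x j (λ j′ → g≤h (inj₂ j′)) x+g≤h))

-- Every active neighbour contributes at least 1 to f(N[v]), and w at least k + 1.
high-neighbour-dominates : ∀ {ℓ σ} (D : LP0Data ℓ σ) (f : V ℓ σ → ℕ) k v w →
                           T (adj D v w) → suc k ≤ f w → k + activeNbrs D f v ≤ fClosedNbhd D f v
high-neighbour-dominates {ℓ} {σ} D f k v w v~w k<fw =
  sumV-mono-with ℓ σ k w (λ u → counted≤weighed (adj D v u) (eqV v u) (f u)) (at-w (adj D v w) v~w (f w) k<fw)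
  where
  counted≤weighed : ∀ a e y → b2n (a ∧ (1 ≤ᵇ y)) ≤ (if a ∨ e then y else 0)
  counted≤weighed false e y       = z≤n
  counted≤weighed true  e zero    = z≤n
  counted≤weighed true  e (suc y) = s≤s z≤n
  at-w : ∀ a → T a → ∀ y → suc k ≤ y → k + b2n (a ∧ (1 ≤ᵇ y)) ≤ (if a ∨ eqV v w then y else 0)
  at-w true _ (suc y) k<y = subst (_≤ suc y) (+-comm 1 k) k<y
  at-w true _ zero    ()

data BlockEdge {ℓ σ} (D : LP0Data ℓ σ) (i j : Fin ℓ) (a b : Fin 7) : Set where
  inner-edge  : toℕ i ≡ toℕ j → T (inner (toℕ a) (toℕ b)) → BlockEdge D i j a b
  cross-edge  : nx ℓ (toℕ i) ≡ toℕ j → T (cross (twist D i) (toℕ a) (toℕ b)) → BlockEdge D i j a b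
  repair-edge : T (repair D i) → a ≡ 𝐭 → BlockEdge D i j a b

block-edge : ∀ {ℓ σ} (D : LP0Data ℓ σ) i j a b →
             T (edge D (inj₁ (i , a)) (inj₁ (j , b))) → BlockEdge D i j a b
block-edge {ℓ} D i j a b e with to (T-∨ {(toℕ i ≡ᵇ toℕ j) ∧ inner (toℕ a) (toℕ b)}) e
... | inj₁ e-in = let (i≡j , in-ab) = to (T-∧ {toℕ i ≡ᵇ toℕ j}) e-in in
  inner-edge (≡ᵇ⇒≡ _ _ i≡j) in-ab
... | inj₂ e′ with to (T-∨ {(nx ℓ (toℕ i) ≡ᵇ toℕ j) ∧ cross (twist D i) (toℕ a) (toℕ b)}) e′
...   | inj₁ e-cr = let (i→j , cr-ab) = to (T-∧ {nx ℓ (toℕ i) ≡ᵇ toℕ j}) e-cr in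
  cross-edge (≡ᵇ⇒≡ _ _ i→j) cr-ab
...   | inj₂ e-rp with to (T-∧ {repair D i}) e-rp
...     | rp , e-rest with to (T-∧ {toℕ a ≡ᵇ 4}) (proj₂ (to (T-∧ {nx ℓ (toℕ i) ≡ᵇ toℕ j}) e-rest))
...       | a≡4 , _ = repair-edge rp (toℕ-injective (≡ᵇ⇒≡ (toℕ a) 4 a≡4))

adj-sym : ∀ {ℓ σ} (D : LP0Data ℓ σ) v w → adj D v w ≡ adj D w v
adj-sym D v w = ∨-comm (edge D v w) (edge D w v)

inner-adj : ∀ {ℓ σ} (D : LP0Data ℓ σ) i (a b : Fin 7) →
            T (inner (toℕ a) (toℕ b)) → T (adj D (inj₁ (i , a)) (inj₁ (i , b)))
inner-adj D i a b ab rewrite dec-true (toℕ i ≟ toℕ i) refl | to T-≡ ab = tt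

block-adj : ∀ {ℓ σ} (D : LP0Data ℓ σ) i (a b : Fin 7) →
            T (inner (toℕ a) (toℕ b) ∨ inner (toℕ b) (toℕ a)) → T (adj D (inj₁ (i , a)) (inj₁ (i , b)))
block-adj D i a b ab∨ba with to (T-∨ {inner (toℕ a) (toℕ b)}) ab∨ba
... | inj₁ ab = inner-adj D i a b ab
... | inj₂ ba = subst T (adj-sym D (inj₁ (i , b)) (inj₁ (i , a))) (inner-adj D i b a ba)

cross-adj : ∀ {ℓ σ} (D : LP0Data ℓ σ) i j (a b : Fin 7) → nx ℓ (toℕ i) ≡ toℕ j →
            T (cross (twist D i) (toℕ a) (toℕ b)) → T (adj D (inj₁ (i , a)) (inj₁ (j , b)))
cross-adj {ℓ} D i j a b i→j ab
  rewrite dec-true (nx ℓ (toℕ i) ≟ toℕ j) i→j | to T-≡ ab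
        | ∨-zeroʳ ((toℕ i ≡ᵇ toℕ j) ∧ inner (toℕ a) (toℕ b)) = tt

link-adj : ∀ {ℓ σ} (D : LP0Data ℓ σ) j i → T (inTriple ℓ (toℕ (start D j)) (toℕ i)) →
           T (adj D (inj₂ j) (inj₁ (i , 𝐭)))
link-adj D j i i∈j = from T-∨ (inj₁ i∈j)

bound-arithmetic : ∀ k u s → 1 ≤ k →
                   u * (2 * (k + 1)) + s * (7 * k + 5) ≡ 2 * (k + 1) * (u * 1 + s * 3) + (k ∸ 1) * s
bound-arithmetic (suc k′) u s _ = identity k′ u s
  where
  identity : ∀ k′ u s → u * (2 * (suc k′ + 1)) + s * (7 * suc k′ + 5)
                        ≡ 2 * (suc k′ + 1) * (u * 1 + s * 3) + k′ * s
  identity = solve-∀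

module Labelling {ℓ σ : ℕ} (k : ℕ) (D : LP0Data ℓ σ) (3≤ℓ : 3 ≤ ℓ) (valid : ValidLP0 D) where

  value : Level → ℕ
  value none = 0
  value low  = k
  value high = suc k

  base : Fin σ → ℕ
  base j = toℕ (start D j)

  base<ℓ : ∀ j → base j < ℓ
  base<ℓ j = toℕ<n (start D j)

  linkCount : ℕ → ℕ
  linkCount n = sumFin σ (λ j → b2n (inTriple ℓ (base j) n))

  repairCount : Fin ℓ → ℕ
  repairCount x = sumFin ℓ (λ i → b2n (repair D i ∧ ((toℕ i ≡ᵇ toℕ x) ∨ (nx ℓ (toℕ i) ≡ᵇ toℕ x))))

  linkCount≤1 : ∀ {n} → n < ℓ → linkCount n ≤ 1
  linkCount≤1 {n} n<ℓ =
    subst (λ m → linkCount m ≤ 1) (toℕ-fromℕ< n<ℓ)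
          (≤-trans (m≤m+n _ (repairCount (fromℕ< n<ℓ))) (≤-reflexive (valid (fromℕ< n<ℓ))))

  inTriple⇒1≤linkCount : ∀ {n} j → T (inTriple ℓ (base j) n) → 1 ≤ linkCount n
  inTriple⇒1≤linkCount {n} j t = subst (_≤ linkCount n) (b2n-T t) (term≤sumFin σ _ j)

  triples-disjoint : ∀ {n} j j′ → n < ℓ →
                     T (inTriple ℓ (base j) n) → T (inTriple ℓ (base j′) n) → j ≡ j′
  triples-disjoint {n} j j′ n<ℓ t t′ with j ≟ᶠ j′
  ... | yes j≡j′ = j≡j′
  ... | no  j≢j′ = ⊥-elim (<⇒≱ (≤-refl {2}) (begin
      2                                                           ≡⟨ sym (cong₂ _+_ (b2n-T t) (b2n-T t′)) ⟩
      b2n (inTriple ℓ (base j) n) + b2n (inTriple ℓ (base j′) n)  ≤⟨ two-terms≤sumFin σ _ j≢j′ ⟩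
      linkCount n                                                 ≤⟨ linkCount≤1 n<ℓ ⟩
      1                                                           ∎))
    where open ≤-Reasoning

  repaired⇒unlinked : ∀ i j → T (repair D i) → ¬ T (inTriple ℓ (base j) (toℕ i))
  repaired⇒unlinked i j rp t = <⇒≱ (≤-refl {2}) (begin
      2                                  ≤⟨ +-mono-≤ (inTriple⇒1≤linkCount {toℕ i} j t) has-repair ⟩
      linkCount (toℕ i) + repairCount i  ≡⟨ valid i ⟩
      1                                  ∎)
    where
    open ≤-Reasoning
    own-edge : T (repair D i ∧ ((toℕ i ≡ᵇ toℕ i) ∨ (nx ℓ (toℕ i) ≡ᵇ toℕ i)))
    own-edge rewrite to T-≡ rp | dec-true (toℕ i ≟ toℕ i) refl = tt
    has-repair : 1 ≤ repairCount i
    has-repair = subst (_≤ repairCount i) (b2n-T own-edge) (term≤sumFin ℓ _ i)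

  data Position (n : ℕ) : Role → Set where
    unlinked-at : (∀ j → ¬ T (inTriple ℓ (base j) n)) → Position n repaired
    linked-at   : ∀ j x → n ≡ shift ℓ x (base j) → Position n (linked x)

  position : ∀ n → Σ Role (Position n)
  position n with any? (λ j → T? (inTriple ℓ (base j) n))
  ... | no  n∉ = repaired , unlinked-at (λ j t → n∉ (j , t))
  ... | yes (j , t) = let (x , n≡) = inTriple⇒shift ℓ (base j) n t in linked x , linked-at j x n≡

  -- g at the role of block n (atRole-position), in a closed form that can be summed over n.
  atRole : (Role → ℕ) → ℕ → ℕ
  atRole g n = [ linkCount n ≡ᵇ 0 ]· g repaired + sumFin σ (λ j → atPlace ℓ (base j) n (g ∘ linked))

  atRole-position : ∀ g {n r} → Position n r → atRole g n ≡ g r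
  atRole-position g {n} (unlinked-at n∉) = begin
      [ linkCount n ≡ᵇ 0 ]· g repaired + sumFin σ (λ j → atPlace ℓ (base j) n (g ∘ linked))
    ≡⟨ cong₂ _+_ (cong (λ m → [ m ≡ᵇ 0 ]· g repaired) n-unlinked)
                 (trans (sumFin-cong σ (λ j → atPlace-outside {ℓ} (base j) n (g ∘ linked) (n∉ j)))
                        (sumFin-0 σ)) ⟩
      g repaired + 0
    ≡⟨ +-identityʳ (g repaired) ⟩
      g repaired ∎
    where
    open ≡-Reasoning
    n-unlinked : linkCount n ≡ 0
    n-unlinked = trans (sumFin-cong σ (λ j → b2n-¬T (n∉ j))) (sumFin-0 σ)
  atRole-position g (linked-at j x refl) = begin
      [ linkCount n ≡ᵇ 0 ]· g repaired + sumFin σ (λ j′ → atPlace ℓ (base j′) n (g ∘ linked))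
    ≡⟨ cong₂ _+_ ([≡ᵇ]·-≢ {linkCount n} {0} (g repaired) (λ n↦0 → 1+n≰n (subst (1 ≤_) n↦0 n-linked)))
                 (sumFin-single σ _ j others) ⟩
      atPlace ℓ (base j) n (g ∘ linked)
    ≡⟨ atPlace-shift {ℓ} (base j) x (g ∘ linked) 3≤ℓ ⟩
      g (linked x) ∎
    where
    open ≡-Reasoning
    n = shift ℓ x (base j)
    n∈j : T (inTriple ℓ (base j) n)
    n∈j = inTriple-shift ℓ (base j) x refl
    n-linked : 1 ≤ linkCount n
    n-linked = inTriple⇒1≤linkCount {n} j n∈j
    others : ∀ j′ → j′ ≢ j → atPlace ℓ (base j′) n (g ∘ linked) ≡ 0
    others j′ j′≢j = atPlace-outside {ℓ} (base j′) n (g ∘ linked)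
      (λ n∈j′ → j′≢j (triples-disjoint j′ j (shift<ℓ x (base<ℓ j)) n∈j′ n∈j))

  f : V ℓ σ → ℕ
  f (inj₁ (i , c)) = atRole (λ r → value (label r c)) (toℕ i)
  f (inj₂ _)       = 0

  f-block : ∀ {i r} → Position (toℕ i) r → ∀ c → f (inj₁ (i , c)) ≡ value (label r c)
  f-block pos c = atRole-position (λ r → value (label r c)) pos

  f≤k+1 : ∀ v → f v ≤ k + 1
  f≤k+1 (inj₁ (i , c)) = let (r , pos) = position (toℕ i) in
    subst (_≤ k + 1) (sym (f-block pos c)) (value≤k+1 (label r c))
    where
    value≤k+1 : ∀ l → value l ≤ k + 1
    value≤k+1 none = z≤n
    value≤k+1 low  = m≤m+n k 1
    value≤k+1 high = ≤-reflexive (+-comm 1 k)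
  f≤k+1 (inj₂ _) = z≤n

  unlinkedCount : ℕ
  unlinkedCount = sumFin ℓ (λ i → [ linkCount (toℕ i) ≡ᵇ 0 ]· 1)

  sumFin-atRole : ∀ g → sumFin ℓ (λ i → atRole g (toℕ i))
                        ≡ unlinkedCount * g repaired + σ * sumPlaces (g ∘ linked)
  sumFin-atRole g = begin
      sumFin ℓ (λ i → atRole g (toℕ i))
    ≡⟨ sumFin-distrib-+ ℓ _ _ ⟩
      sumFin ℓ (λ i → [ linkCount (toℕ i) ≡ᵇ 0 ]· g repaired) + sumFin ℓ (λ i → sumFin σ (λ j → linkedAt j i))
    ≡⟨ cong₂ _+_ (sumFin-[]·-const ℓ _ (g repaired)) (sumFin-comm ℓ σ _) ⟩
      unlinkedCount * g repaired + sumFin σ (λ j → sumFin ℓ (linkedAt j))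
    ≡⟨ cong (unlinkedCount * g repaired +_)
            (trans (sumFin-cong σ (λ j → sumFin-atPlace (base j) (g ∘ linked) (base<ℓ j))) (sumFin-const σ _)) ⟩
      unlinkedCount * g repaired + σ * sumPlaces (g ∘ linked) ∎
    where
    open ≡-Reasoning
    linkedAt : Fin σ → Fin ℓ → ℕ
    linkedAt j i = atPlace ℓ (base j) (toℕ i) (g ∘ linked)

  ℓ-decomposition : ℓ ≡ unlinkedCount * 1 + σ * 3
  ℓ-decomposition = begin
      ℓ                                           ≡⟨ sym (*-identityʳ ℓ) ⟩
      ℓ * 1                                       ≡⟨ sym (sumFin-const ℓ 1) ⟩
      sumFin ℓ (λ _ → 1)                          ≡⟨ sumFin-cong ℓ (λ i → sym (atRole-const-1 i)) ⟩
      sumFin ℓ (λ i → atRole (λ _ → 1) (toℕ i))   ≡⟨ sumFin-atRole (λ _ → 1) ⟩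
      unlinkedCount * 1 + σ * 3                   ∎
    where
    open ≡-Reasoning
    atRole-const-1 : ∀ i → atRole (λ _ → 1) (toℕ i) ≡ 1
    atRole-const-1 i = atRole-position (λ _ → 1) (proj₂ (position (toℕ i)))

  blockWeight : Role → ℕ
  blockWeight r = sumFin 7 (λ c → value (label r c))

  weight-decomposition : weight f ≡ unlinkedCount * blockWeight repaired + σ * sumPlaces (blockWeight ∘ linked)
  weight-decomposition = begin
      sumFin ℓ (λ i → sumFin 7 (λ c → f (inj₁ (i , c)))) + sumFin σ (λ _ → 0)
    ≡⟨ cong₂ _+_ (sumFin-cong ℓ block-sum) (sumFin-0 σ) ⟩
      sumFin ℓ (λ i → atRole blockWeight (toℕ i)) + 0
    ≡⟨ trans (+-identityʳ _) (sumFin-atRole blockWeight) ⟩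
      unlinkedCount * blockWeight repaired + σ * sumPlaces (blockWeight ∘ linked) ∎
    where
    open ≡-Reasoning
    block-sum : ∀ i → sumFin 7 (λ c → f (inj₁ (i , c))) ≡ atRole blockWeight (toℕ i)
    block-sum i = let (r , pos) = position (toℕ i) in
      trans (sumFin-cong 7 (f-block pos)) (sym (atRole-position blockWeight pos))

  repaired-weight : blockWeight repaired ≡ 2 * (k + 1)
  repaired-weight = begin
    blockWeight repaired ≡⟨⟩
    suc k + (suc k + 0)  ≡⟨ solve (k ∷ []) ⟩
    2 * (k + 1)          ∎
    where open ≡-Reasoning

  link-weight : sumPlaces (blockWeight ∘ linked) ≡ 7 * k + 5
  link-weight = begin
    sumPlaces (blockWeight ∘ linked)                                             ≡⟨⟩
    (suc k + (k + (suc k + 0))) + ((suc k + 0) + (suc k + (k + (suc k + 0))))  ≡⟨ solve (k ∷ []) ⟩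
    7 * k + 5                                                                    ∎
    where open ≡-Reasoning

  weight-value : 1 ≤ k → weight f ≡ 2 * (k + 1) * ℓ + (k ∸ 1) * σ
  weight-value 1≤k = begin
      weight f
    ≡⟨ weight-decomposition ⟩
      unlinkedCount * blockWeight repaired + σ * sumPlaces (blockWeight ∘ linked)
    ≡⟨ cong₂ (λ a b → unlinkedCount * a + σ * b) repaired-weight link-weight ⟩
      unlinkedCount * (2 * (k + 1)) + σ * (7 * k + 5)
    ≡⟨ bound-arithmetic k unlinkedCount σ 1≤k ⟩
      2 * (k + 1) * (unlinkedCount * 1 + σ * 3) + (k ∸ 1) * σ
    ≡⟨ cong (λ m → 2 * (k + 1) * m + (k ∸ 1) * σ) ℓ-decomposition ⟨
      2 * (k + 1) * ℓ + (k ∸ 1) * σ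
    ∎
    where open ≡-Reasoning

  next : Fin ℓ → Fin ℓ
  next i = fromℕ< (nx<ℓ (toℕ<n i))

  toℕ-next : ∀ i → toℕ (next i) ≡ nx ℓ (toℕ i)
  toℕ-next i = toℕ-fromℕ< (nx<ℓ (toℕ<n i))

  HighNeighbour : V ℓ σ → Set
  HighNeighbour v = Σ[ w ∈ V ℓ σ ] T (adj D v w) × f w ≡ suc k

  block-high-neighbour : ∀ i c {r} → Position (toℕ i) r → label r c ≡ none →
                         HighNeighbour (inj₁ (i , c))
  block-high-neighbour i c {r} pos c-none with high-spot r c c-none
  ... | inside c′ c~c′ c′-high =
    inj₁ (i , c′) , block-adj D i c c′ c~c′ , trans (f-block pos c′) (cong value c′-high)
  ... | before refl high-before with pos
  ...   | linked-at j .middle i≡ =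
    let (a , a→c , a-high) = high-before (twist D (start D j)) in
    inj₁ (start D j , a) ,
    subst T (adj-sym D (inj₁ (start D j , a)) (inj₁ (i , c)))
            (cross-adj D (start D j) i a c (sym i≡) a→c) ,
    trans (f-block (linked-at j first refl) a) (cong value a-high)
  block-high-neighbour i c pos _ | after refl high-after with pos
  ...   | linked-at j .middle i≡ =
    let (b , c→b , b-high) = high-after (twist D i) in
    inj₁ (next i , b) ,
    cross-adj D i (next i) c b (sym (toℕ-next i)) c→b ,
    trans (f-block (linked-at j last (trans (toℕ-next i) (cong (nx ℓ) i≡))) b) (cong value b-high)

  link-high-neighbour : ∀ j → HighNeighbour (inj₂ j)
  link-high-neighbour j =
    inj₁ (next (start D j) , 𝐭) ,
    link-adj D j (next (start D j)) (inTriple-shift ℓ (base j) middle (toℕ-next (start D j))) ,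
    f-block (linked-at j middle (toℕ-next (start D j))) 𝐭

  high-neighbour : ∀ v → f v < k → HighNeighbour v
  high-neighbour (inj₁ (i , c)) fv<k =
    let (r , pos) = position (toℕ i) in
    block-high-neighbour i c pos (value<k⇒none (label r c) (subst (_< k) (f-block pos c) fv<k))
    where
    value<k⇒none : ∀ l → value l < k → l ≡ none
    value<k⇒none none _       = refl
    value<k⇒none low  k<k     = ⊥-elim (n≮n k k<k)
    value<k⇒none high 1+k<k   = ⊥-elim (n≮n k (<-trans (n<1+n k) 1+k<k))
  high-neighbour (inj₂ j) _ = link-high-neighbour j

  dominating : ∀ v → f v < k → k + activeNbrs D f v ≤ fClosedNbhd D f v
  dominating v fv<k =
    let (w , v~w , fw≡) = high-neighbour v fv<k in
    high-neighbour-dominates D f k v w v~w (≤-reflexive (sym fw≡))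

  f-positive⇒active : ∀ {i r} → Position (toℕ i) r → ∀ c → 1 ≤ f (inj₁ (i , c)) →
                      T (active (label r c))
  f-positive⇒active pos c 1≤f = positive⇒active (label _ c) (subst (1 ≤_) (f-block pos c) 1≤f)
    where
    positive⇒active : ∀ l → 1 ≤ value l → T (active l)
    positive⇒active low  _ = tt
    positive⇒active high _ = tt

  edge-independent : ∀ v w → T (edge D v w) → 1 ≤ f v → 1 ≤ f w → ⊥
  edge-independent (inj₁ (i , a)) (inj₁ (j , b)) e fa fb with position (toℕ i) | block-edge D i j a b e
  ... | r , pos | inner-edge i≡j ab =
    block-independent r a b ab (f-positive⇒active pos a fa)
                               (f-positive⇒active (subst (λ n → Position n r) i≡j pos) b fb)
  ... | r , pos | cross-edge i→j ab
    with active-exit⇒first r (twist D i) a b ab (f-positive⇒active pos a fa)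
  ...   | refl with pos
  ...     | linked-at j′ .first i≡ =
    middle-entries-inactive (twist D i) a b ab (f-positive⇒active (linked-at j′ middle j-middle) b fb)
    where
    j-middle : toℕ j ≡ nx ℓ (base j′)
    j-middle = trans (sym i→j) (cong (nx ℓ) i≡)
  edge-independent (inj₁ (i , a)) (inj₁ (j , b)) e fa fb | _ , unlinked-at i∉ | repair-edge _ refl =
    f-positive⇒active {i} (unlinked-at i∉) 𝐭 fa
  edge-independent (inj₁ (i , a)) (inj₁ (j , b)) e fa fb | _ , linked-at j′ x i≡ | repair-edge rp refl =
    repaired⇒unlinked i j′ rp (inTriple-shift ℓ (base j′) x i≡)
  edge-independent (inj₂ _) _ _ ()
  edge-independent (inj₁ _) (inj₂ _) ()

  independent : ∀ v w → adj D v w ≡ true → 1 ≤ f v → 1 ≤ f w → ⊥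
  independent v w v~w fv fw with to (T-∨ {edge D v w}) (from T-≡ v~w)
  ... | inj₁ v→w = edge-independent v w v→w fv fw
  ... | inj₂ w→v = edge-independent w v w→v fw fv

theorem5p2 : (k ℓ σ : ℕ) → 1 ≤ k → 3 ≤ ℓ → Odd ℓ → Odd σ → 1 ≤ σ → σ ≤ ℓ / 3 →
    (D : LP0Data ℓ σ) → ValidLP0 D →
    IKRDomLe D k (2 * (k + 1) * ℓ + (k ∸ 1) * σ)
theorem5p2 k ℓ σ 1≤k 3≤ℓ _ _ _ _ D valid =
  f , ((f≤k+1 , dominating) , independent) , ≤-reflexive (weight-value 1≤k)
  where open Labelling k D 3≤ℓ valid
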